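{- Let $s,t$ be coprime integers greater than $1$, $\sigma$ an $s$-core, $\tau$ a $t$-core and $n\ge0$. Then $\mathcal P_{\sigma,\tau}(n)\neq\emptyset$ if and only if $n\ge m_{\sigma,\tau}$ and $n\equiv m_{\sigma,\tau}\pmod{st}$. Furthermore, if $n>m_{\sigma,\tau}$ and $n\equiv m_{\sigma,\tau}\pmod{st}$, then $|\mathcal P_{\sigma,\tau}(n)|\ge st$.
   Context: Partitions; a rim $s$-hook is a connected set of $s$ nodes of the rim of the Young diagram whose removal leaves a partition's diagram; $s$-core: no rim $s$-hook; the $s$-core of $\lambda$ is obtained by repeatedly removing rim $s$-hooks. $\mathcal P_{\sigma,\tau}(n)$ is the set of partitions of $n$ with $s$-core $\sigma$ and $t$-core $\tau$. $m_{\sigma,\tau}$ is the common size of the $(s,t)$-minimal partitions with $s$-core $\sigma$ and $t$-core $\tau$, where a partition is $(s,t)$-minimal if no smaller partition has the same $s$-core and $t$-core (i.e. $m_{\sigma,\tau}$ is the least $n$ with $\mathcal P_{\sigma,\tau}(n)\ne\emptyset$; such $n$ exists). -}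

module Defs where

open import Data.Nat using (ℕ; zero; suc; _+_; _*_; _∸_; _≤_; _<_; _≥_)
open import Data.Nat.Divisibility using (_∣_)
open import Data.Nat.Coprimality using (Coprime)
open import Data.List using (List; []; _∷_; length)
open import Data.Nat.ListAction using (sum)
open import Data.List.Relation.Unary.All using (All)
open import Data.List.Relation.Unary.Linked using (Linked)
open import Data.List.Relation.Unary.Unique.Propositional using (Unique)
open import Data.Product using (_×_; ∃; ∃-syntax; Σ-syntax; _,_)
open import Data.Sum using (_⊎_)
open import Relation.Nullary using (¬_)
open import Relation.Binary.PropositionalEquality using (_≡_)
open import Relation.Binary.Construct.Closure.ReflexiveTransitive using (Star)

IsPartition : List ℕ → Set
IsPartition λs = Linked (λ a b → b ≤ a) λs × All (λ a → 1 ≤ a) λs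

size : List ℕ → ℕ
size = sum

part : List ℕ → ℕ → ℕ
part []       _       = 0
part (x ∷ xs) zero    = x
part (x ∷ xs) (suc i) = part xs i

-- Young diagrams: cells (i , j) (row i, column j, 0-indexed)

Cell : Set
Cell = ℕ × ℕ

_∈ᴰ_ : Cell → List ℕ → Set
(i , j) ∈ᴰ λs = j < part λs i

InRim : List ℕ → Cell → Set
InRim λs (i , j) = ((i , j) ∈ᴰ λs) × ¬ ((suc i , suc j) ∈ᴰ λs)

Adjacent : Cell → Cell → Set
Adjacent (i , j) (k , l) =
  ((suc i ≡ k) × (j ≡ l)) ⊎ ((i ≡ suc k) × (j ≡ l)) ⊎
  ((i ≡ k) × (suc j ≡ l)) ⊎ ((i ≡ k) × (j ≡ suc l))

data Walk (S : Cell → Set) : Cell → Cell → Set where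
  here : ∀ {c} → S c → Walk S c c
  step : ∀ {c d e} → S c → Adjacent c d → Walk S d e → Walk S c e

Connected : (Cell → Set) → Set
Connected S = ∀ c d → S c → S d → Walk S c d

Skew : List ℕ → List ℕ → Cell → Set
Skew λs μs c = (c ∈ᴰ λs) × ¬ (c ∈ᴰ μs)

record RemoveRimHook (s : ℕ) (λs μs : List ℕ) : Set where
  field
    μ-partition : IsPartition μs
    contained   : ∀ i → part μs i ≤ part λs i
    hookSize    : size λs ≡ size μs + s
    inRim       : ∀ c → Skew λs μs c → InRim λs c
    connected   : Connected (Skew λs μs)

IsCore : ℕ → List ℕ → Set
IsCore s λs = ¬ (∃[ μs ] RemoveRimHook s λs μs)

HasCore : ℕ → List ℕ → List ℕ → Set
HasCore s λs κ = Star (RemoveRimHook s) λs κ × IsCore s κ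

InP : ℕ → ℕ → List ℕ → List ℕ → ℕ → List ℕ → Set
InP s t σ τ n λs = IsPartition λs × size λs ≡ n × HasCore s λs σ × HasCore t λs τ

PNonempty : ℕ → ℕ → List ℕ → List ℕ → ℕ → Set
PNonempty s t σ τ n = ∃[ λs ] InP s t σ τ n λs

CardAtLeast : ℕ → ℕ → List ℕ → List ℕ → ℕ → ℕ → Set
CardAtLeast s t σ τ n k =
  ∃[ ps ] (length ps ≡ k × Unique ps × All (InP s t σ τ n) ps)

IsMinSize : ℕ → ℕ → List ℕ → List ℕ → ℕ → Set
IsMinSize s t σ τ m = PNonempty s t σ τ m × (∀ k → k < m → ¬ PNonempty s t σ τ k)

-- Read a partition as a word of beads (rows) and gaps (columns).  Sliding a bead s places
-- forward into a gap removes a rim s-hook, so partitions with the same s-core have sizes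
-- congruent modulo s; by coprimality and the minimality of m this gives the necessary
-- conditions.  Conversely, take μ ∈ 𝒫_{σ,τ}(m) and pad its word; on each of the st runners
-- modulo st, moving the first bead back by k st places yields a partition of size m + k st,
-- and these st partitions are distinct.  The long move is undone by k t slides of length s
-- and also by k s slides of length t, so each of them still has s-core σ and t-core τ.

module Submission where

open import Defs
open import Data.Bool using (Bool; true; false)
open import Data.Empty using (⊥-elim)
open import Data.Fin using (Fin; zero; toℕ)
open import Data.Fin.Properties using (toℕ<n; toℕ-injective)
open import Data.List using (List; []; _∷_; length; replicate; _++_; map; allFin)
open import Data.List.Properties using (length-replicate; length-map; length-tabulate)
open import Data.List.Relation.Unary.All using (All; []; _∷_)
open import Data.List.Relation.Unary.All.Properties using (tabulate⁺) renaming (map⁺ to All-map⁺)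
open import Data.List.Relation.Unary.Linked using ([]; [-]; _∷_)
open import Data.List.Relation.Unary.Unique.Propositional using (Unique)
open import Data.List.Relation.Unary.Unique.Propositional.Properties using (allFin⁺) renaming (map⁺ to Unique-map⁺)
open import Data.Nat using (ℕ; zero; suc; pred; _+_; _*_; _∸_; _≤_; _<_; z≤n; s≤s; _%_; _≤?_; _≟_)
open import Data.Nat.Coprimality using (Coprime; coprime⇒gcd≡1)
open import Data.Nat.Divisibility using (_∣_; divides)
open import Data.Nat.DivMod using ([m+kn]%n≡m%n; m≤n⇒m%n≡m)
open import Data.Nat.LCM using (lcm; lcm-least; gcd*lcm)
open import Data.Nat.Properties
open import Data.Nat.Tactic.RingSolver using (solve-∀)
open import Data.Product using (_×_; ∃-syntax; Σ-syntax; _,_; proj₁; proj₂)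
open import Data.Sum using (inj₁; inj₂)
open import Function.Bundles using (_⇔_; mk⇔)
open import Function.Definitions using (Injective)
open import Relation.Nullary using (¬_; yes; no)
open import Relation.Nullary.Decidable using (decidable-stable)
open import Relation.Binary.PropositionalEquality
open import Relation.Binary.Construct.Closure.ReflexiveTransitive using (Star; ε; _◅_; _◅◅_)

Adjacent-sym : ∀ {c d} → Adjacent c d → Adjacent d c
Adjacent-sym (inj₁ (p , q))                = inj₂ (inj₁ (sym p , sym q))
Adjacent-sym (inj₂ (inj₁ (p , q)))         = inj₁ (sym p , sym q)
Adjacent-sym (inj₂ (inj₂ (inj₁ (p , q)))) = inj₂ (inj₂ (inj₂ (sym p , sym q)))
Adjacent-sym (inj₂ (inj₂ (inj₂ (p , q)))) = inj₂ (inj₂ (inj₁ (sym p , sym q)))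

Adjacent-up : ∀ {i j} → Adjacent (suc i , j) (i , j)
Adjacent-up = inj₂ (inj₁ (refl , refl))

Adjacent-right : ∀ {i j} → Adjacent (i , j) (i , suc j)
Adjacent-right = inj₂ (inj₂ (inj₁ (refl , refl)))

nextRow : Cell → Cell
nextRow (i , j) = (suc i , j)

Adjacent-nextRow : ∀ {c d} → Adjacent c d → Adjacent (nextRow c) (nextRow d)
Adjacent-nextRow (inj₁ (p , q))                = inj₁ (cong suc p , q)
Adjacent-nextRow (inj₂ (inj₁ (p , q)))         = inj₂ (inj₁ (cong suc p , q))
Adjacent-nextRow (inj₂ (inj₂ (inj₁ (p , q)))) = inj₂ (inj₂ (inj₁ (cong suc p , q)))
Adjacent-nextRow (inj₂ (inj₂ (inj₂ (p , q)))) = inj₂ (inj₂ (inj₂ (cong suc p , q)))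

walk-++ : ∀ {S c d e} → Walk S c d → Walk S d e → Walk S c e
walk-++ (here _)     w = w
walk-++ (step x a v) w = step x a (walk-++ v w)

walk-snoc : ∀ {S c d e} → Walk S c d → Adjacent d e → S e → Walk S c e
walk-snoc (here x)     b se = step x b (here se)
walk-snoc (step x a v) b se = step x a (walk-snoc v b se)

walk-reverse : ∀ {S c d} → Walk S c d → Walk S d c
walk-reverse (here x)     = here x
walk-reverse (step x a v) = walk-snoc (walk-reverse v) (Adjacent-sym a) x

walk-mono : ∀ {S S' : Cell → Set} → (∀ {c} → S c → S' c) → ∀ {c d} → Walk S c d → Walk S' c d
walk-mono g (here x)     = here (g x)
walk-mono g (step x a v) = step (g x) a (walk-mono g v)

walk-nextRow : ∀ {S S' : Cell → Set} → (∀ {c} → S c → S' (nextRow c)) →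
               ∀ {c d} → Walk S c d → Walk S' (nextRow c) (nextRow d)
walk-nextRow g (here x)     = here (g x)
walk-nextRow g (step x a v) = step (g x) (Adjacent-nextRow a) (walk-nextRow g v)

infixr 5 _∷⁺_

_∷⁺_ : ℕ → List ℕ → List ℕ
zero  ∷⁺ l = []
suc n ∷⁺ l = suc n ∷ l

∷⁺-suc : ∀ {z} l → 1 ≤ z → z ∷⁺ l ≡ z ∷ l
∷⁺-suc {suc z} l _ = refl

head-∷⁺ : ∀ z l → part (z ∷⁺ l) 0 ≡ z
head-∷⁺ zero    l = refl
head-∷⁺ (suc z) l = refl

∷⁺-injectiveʳ : ∀ y l z l' → suc y ∷⁺ l ≡ z ∷⁺ l' → suc y ≡ z → l ≡ l'
∷⁺-injectiveʳ y l .(suc y) l' refl refl = refl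

part-∷⁺ : ∀ z l → (z ≡ 0 → l ≡ []) → ∀ i → part (z ∷⁺ l) i ≡ part (z ∷ l) i
part-∷⁺ zero l l≡[] i with l≡[] refl
part-∷⁺ zero .[] _ zero    | refl = refl
part-∷⁺ zero .[] _ (suc i) | refl = refl
part-∷⁺ (suc z) l _ i = refl

size-∷⁺ : ∀ z l → (z ≡ 0 → l ≡ []) → size (z ∷⁺ l) ≡ z + size l
size-∷⁺ zero l l≡[] with l≡[] refl
... | refl = refl
size-∷⁺ (suc z) l _ = refl

IsPartition-tail : ∀ {x l} → IsPartition (x ∷ l) → IsPartition l
IsPartition-tail {l = []}    _                = [] , []
IsPartition-tail {l = y ∷ l} (_ ∷ lk , _ ∷ al) = lk , al

IsPartition-head : ∀ {x l} → IsPartition (x ∷ l) → part l 0 ≤ x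
IsPartition-head {l = []}    _            = z≤n
IsPartition-head {l = y ∷ l} (y≤x ∷ _ , _) = y≤x

IsPartition-∷ : ∀ {x l} → IsPartition l → part l 0 ≤ x → 1 ≤ x → IsPartition (x ∷ l)
IsPartition-∷ {l = []}    _         _   1≤x = [-] , 1≤x ∷ []
IsPartition-∷ {l = y ∷ l} (lk , al) y≤x 1≤x = y≤x ∷ lk , 1≤x ∷ al

IsPartition-∷⁺ : ∀ {z l} → IsPartition l → part l 0 ≤ z → IsPartition (z ∷⁺ l)
IsPartition-∷⁺ {zero}  _ _   = [] , []
IsPartition-∷⁺ {suc z} p l≤z = IsPartition-∷ p l≤z (s≤s z≤n)

-- Rim hooks through the end of the first row

-- Connectedness is carried as walks to the last cell of the first row, so that the
-- constructions below extend a hook one cell at a time.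
record TopHook (k : ℕ) (λs μs : List ℕ) : Set where
  field
    partition   : IsPartition μs
    contained   : ∀ i → part μs i ≤ part λs i
    hookSize    : size λs ≡ size μs + k
    inRim       : ∀ c → Skew λs μs c → InRim λs c
    shortensTop : part μs 0 < part λs 0
    toCorner    : ∀ c → Skew λs μs c → Walk (Skew λs μs) c (0 , pred (part λs 0))
open TopHook

TopHook⇒RemoveRimHook : ∀ {k λs μs} → TopHook k λs μs → RemoveRimHook k λs μs
TopHook⇒RemoveRimHook h = record
  { μ-partition = partition h
  ; contained   = contained h
  ; hookSize    = hookSize h
  ; inRim       = inRim h
  ; connected   = λ c d sc sd → walk-++ (toCorner h c sc) (walk-reverse (toCorner h d sd))
  }

TopHook-lastCell : ∀ z l μ → (∀ i → part μ i ≡ part (z ∷ l) i) → size μ ≡ z + size l →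
                   IsPartition μ → part l 0 ≤ z → TopHook 1 (suc z ∷ l) μ
TopHook-lastCell z l μ μ≗ μsize pμ l≤z = record
  { partition   = pμ
  ; contained   = cont
  ; hookSize    = trans (cong suc (sym (+-identityʳ _)))
                    (trans (sym (+-suc (z + size l) 0)) (cong (_+ 1) (sym μsize)))
  ; inRim       = rim
  ; shortensTop = subst (_< suc z) (sym (μ≗ 0)) ≤-refl
  ; toCorner    = walk
  }
  where
  λs = suc z ∷ l
  cont : ∀ i → part μ i ≤ part λs i
  cont zero    = subst (_≤ suc z) (sym (μ≗ 0)) (n≤1+n z)
  cont (suc i) = ≤-reflexive (μ≗ (suc i))
  outside⇒z≤ : ∀ {j} → ¬ (j < part μ 0) → z ≤ j
  outside⇒z≤ {j} j∉ = ≮⇒≥ (λ j<z → j∉ (subst (j <_) (sym (μ≗ 0)) j<z))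
  belowTop : ∀ {i j} → ¬ Skew λs μ (suc i , j)
  belowTop {i} {j} (a , b) = b (subst (j <_) (sym (μ≗ (suc i))) a)
  rim : ∀ c → Skew λs μ c → InRim λs c
  rim (zero , j)  (a , b) = a , λ q → <-irrefl refl (≤-trans q (≤-trans l≤z (≤-trans (outside⇒z≤ b) (n≤1+n j))))
  rim (suc i , j) sk      = ⊥-elim (belowTop sk)
  corner : Skew λs μ (0 , z)
  corner = ≤-refl , λ q → <-irrefl refl (subst (z <_) (μ≗ 0) q)
  walk : ∀ c → Skew λs μ c → Walk (Skew λs μ) c (0 , z)
  walk (zero , j) (a , b) with ≤-antisym (≤-pred a) (outside⇒z≤ b)
  ... | refl = here corner
  walk (suc i , j) sk = ⊥-elim (belowTop sk)

TopHook-extendTop : ∀ {k x ν μ} → TopHook k (x ∷ ν) μ → part ν 0 ≤ x → TopHook (suc k) (suc x ∷ ν) μ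
TopHook-extendTop {x = zero} h _ = ⊥-elim (<-irrefl refl (≤-trans (shortensTop h) z≤n))
TopHook-extendTop {k} {suc x} {ν} {μ} h ν≤x = record
  { partition   = partition h
  ; contained   = cont
  ; hookSize    = trans (cong suc (hookSize h)) (sym (+-suc _ _))
  ; inRim       = rim
  ; shortensTop = ≤-trans (shortensTop h) (n≤1+n _)
  ; toCorner    = walk
  }
  where
  λs  = suc x ∷ ν
  λs' = suc (suc x) ∷ ν
  cont : ∀ i → part μ i ≤ part λs' i
  cont zero    = ≤-trans (contained h 0) (n≤1+n _)
  cont (suc i) = contained h (suc i)
  grow : ∀ {c} → Skew λs μ c → Skew λs' μ c
  grow {zero , j}  (a , b) = ≤-trans a (n≤1+n _) , b
  grow {suc i , j} sk      = sk
  corner : Skew λs' μ (0 , suc x)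
  corner = ≤-refl , λ q → <-asym q (shortensTop h)
  toNewCorner : ∀ c → Skew λs μ c → Walk (Skew λs' μ) c (0 , suc x)
  toNewCorner c sk = walk-snoc (walk-mono grow (toCorner h c sk)) Adjacent-right corner
  rim : ∀ c → Skew λs' μ c → InRim λs' c
  rim (zero , j) (a , b) with m<1+n⇒m<n∨m≡n a
  ... | inj₁ j<  = a , proj₂ (inRim h (0 , j) (j< , b))
  ... | inj₂ refl = a , λ q → <-irrefl refl (≤-trans q (≤-trans ν≤x (n≤1+n _)))
  rim (suc i , j) sk = inRim h (suc i , j) sk
  walk : ∀ c → Skew λs' μ c → Walk (Skew λs' μ) c (0 , suc x)
  walk (zero , j) (a , b) with m<1+n⇒m<n∨m≡n a
  ... | inj₁ j<  = toNewCorner (0 , j) (j< , b)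
  ... | inj₂ refl = here corner
  walk (suc i , j) sk = toNewCorner (suc i , j) sk

-- Stacking a copy of the first row on top moves the hook down a row and adds the end of the new row.
TopHook-stack : ∀ {k y ν μ} → TopHook k (suc y ∷ ν) μ → ∀ μ' → (∀ i → part μ' i ≡ part (y ∷ μ) i) →
                size μ' ≡ y + size μ → IsPartition μ' → TopHook (suc k) (suc y ∷ suc y ∷ ν) μ'
TopHook-stack {k} {y} {ν} {μ} h μ' μ'≗ μ'size pμ' = record
  { partition   = pμ'
  ; contained   = cont
  ; hookSize    = hsize
  ; inRim       = rim
  ; shortensTop = subst (_< suc y) (sym (μ'≗ 0)) ≤-refl
  ; toCorner    = walk
  }
  where
  λs  = suc y ∷ ν
  λs' = suc y ∷ λs
  cont : ∀ i → part μ' i ≤ part λs' i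
  cont zero    = subst (_≤ suc y) (sym (μ'≗ 0)) (n≤1+n y)
  cont (suc i) = subst (_≤ part λs i) (sym (μ'≗ (suc i))) (contained h i)
  hsize : suc y + (suc y + size ν) ≡ size μ' + suc k
  hsize = begin
    suc y + (suc y + size ν) ≡⟨ cong (suc y +_) (hookSize h) ⟩
    suc (y + (size μ + k))   ≡⟨ cong suc (sym (+-assoc y (size μ) k)) ⟩
    suc (y + size μ + k)     ≡⟨ sym (+-suc (y + size μ) k) ⟩
    y + size μ + suc k       ≡⟨ cong (_+ suc k) (sym μ'size) ⟩
    size μ' + suc k          ∎
    where open ≡-Reasoning
  outside⇒y≤ : ∀ {j} → ¬ (j < part μ' 0) → y ≤ j
  outside⇒y≤ {j} j∉ = ≮⇒≥ (λ j<y → j∉ (subst (j <_) (sym (μ'≗ 0)) j<y))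
  up : ∀ {i j} → Skew λs' μ' (suc i , j) → Skew λs μ (i , j)
  up {i} {j} (a , b) = a , λ q → b (subst (j <_) (sym (μ'≗ (suc i))) q)
  down : ∀ {c} → Skew λs μ c → Skew λs' μ' (nextRow c)
  down {i , j} (a , b) = a , λ q → b (subst (j <_) (μ'≗ (suc i)) q)
  rim : ∀ c → Skew λs' μ' c → InRim λs' c
  rim (zero , j)  (a , b) = a , λ q → <-irrefl refl (≤-trans q (s≤s (outside⇒y≤ b)))
  rim (suc i , j) sk      = inRim h (i , j) (up sk)
  corner : Skew λs' μ' (0 , y)
  corner = ≤-refl , λ q → <-irrefl refl (subst (y <_) (μ'≗ 0) q)
  walk : ∀ c → Skew λs' μ' c → Walk (Skew λs' μ') c (0 , y)
  walk (zero , j) (a , b) with ≤-antisym (≤-pred a) (outside⇒y≤ b)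
  ... | refl = here corner
  walk (suc i , j) sk = walk-snoc (walk-nextRow down (toCorner h (i , j) (up sk))) Adjacent-up corner

RemoveRimHook-∷ : ∀ {s z λs μs} → RemoveRimHook s λs μs → IsPartition (z ∷ μs) →
                  RemoveRimHook s (z ∷ λs) (z ∷ μs)
RemoveRimHook-∷ {s} {z} {λs} {μs} r p = record
  { μ-partition = p
  ; contained   = cont
  ; hookSize    = trans (cong (z +_) (RemoveRimHook.hookSize r)) (sym (+-assoc z (size μs) s))
  ; inRim       = rim
  ; connected   = conn
  }
  where
  cont : ∀ i → part (z ∷ μs) i ≤ part (z ∷ λs) i
  cont zero    = ≤-refl
  cont (suc i) = RemoveRimHook.contained r i
  rim : ∀ c → Skew (z ∷ λs) (z ∷ μs) c → InRim (z ∷ λs) c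
  rim (zero , j)  (a , b) = ⊥-elim (b a)
  rim (suc i , j) sk      = RemoveRimHook.inRim r (i , j) sk
  conn : Connected (Skew (z ∷ λs) (z ∷ μs))
  conn (zero , j)  d            (a , b) _       = ⊥-elim (b a)
  conn (suc i , j) (zero , j')  _       (a , b) = ⊥-elim (b a)
  conn (suc i , j) (suc i' , j') sc     sd      =
    walk-nextRow (λ x → x) (RemoveRimHook.connected r (i , j) (i' , j') sc sd)

-- Bead words

-- A word of beads (true) and gaps (false) traces the boundary of a diagram from top right
-- to bottom left: each bead is a row, of length the number of gaps after it.
gaps : List Bool → ℕ
gaps []          = 0
gaps (false ∷ w) = suc (gaps w)
gaps (true ∷ w)  = gaps w

toPartition : List Bool → List ℕ
toPartition []          = []
toPartition (false ∷ w) = toPartition w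
toPartition (true ∷ w)  = gaps w ∷⁺ toPartition w

at : List Bool → ℕ → Bool
at []      _       = false
at (b ∷ _) zero    = b
at (_ ∷ w) (suc i) = at w i

put : List Bool → ℕ → Bool → List Bool
put []      _       _ = []
put (_ ∷ w) zero    b = b ∷ w
put (x ∷ w) (suc i) b = x ∷ put w i b

true≢false : true ≢ false
true≢false ()

move : List Bool → ℕ → ℕ → List Bool
move w i j = put (put w i false) j true

at-true⇒< : ∀ w i → at w i ≡ true → i < length w
at-true⇒< (b ∷ w) zero    _  = s≤s z≤n
at-true⇒< (b ∷ w) (suc i) eq = s≤s (at-true⇒< w i eq)

length-put : ∀ w i b → length (put w i b) ≡ length w
length-put []      i       b = refl
length-put (x ∷ w) zero    b = refl
length-put (x ∷ w) (suc i) b = cong suc (length-put w i b)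

length-move : ∀ w i j → length (move w i j) ≡ length w
length-move w i j = trans (length-put (put w i false) j true) (length-put w i false)

at-put-same : ∀ w i b → i < length w → at (put w i b) i ≡ b
at-put-same (x ∷ w) zero    b _       = refl
at-put-same (x ∷ w) (suc i) b (s≤s l) = at-put-same w i b l

at-put-other : ∀ w i j b → i ≢ j → at (put w j b) i ≡ at w i
at-put-other []      i       j       b i≢j = refl
at-put-other (x ∷ w) zero    zero    b i≢j = ⊥-elim (i≢j refl)
at-put-other (x ∷ w) zero    (suc j) b i≢j = refl
at-put-other (x ∷ w) (suc i) zero    b i≢j = refl
at-put-other (x ∷ w) (suc i) (suc j) b i≢j = at-put-other w i j b (λ e → i≢j (cong suc e))

at-put-false : ∀ w i j → at w j ≡ false → at (put w i false) j ≡ false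
at-put-false []      i       j       eq = refl
at-put-false (x ∷ w) zero    zero    eq = refl
at-put-false (x ∷ w) zero    (suc j) eq = eq
at-put-false (x ∷ w) (suc i) zero    eq = eq
at-put-false (x ∷ w) (suc i) (suc j) eq = at-put-false w i j eq

put-put : ∀ w i b c → put (put w i b) i c ≡ put w i c
put-put []      i       b c = refl
put-put (x ∷ w) zero    b c = refl
put-put (x ∷ w) (suc i) b c = cong (x ∷_) (put-put w i b c)

put-at : ∀ w i b → at w i ≡ b → put w i b ≡ w
put-at []      i       b eq = refl
put-at (x ∷ w) zero    b eq = cong (_∷ w) (sym eq)
put-at (x ∷ w) (suc i) b eq = cong (x ∷_) (put-at w i b eq)

put-comm : ∀ w i j b c → i ≢ j → put (put w i b) j c ≡ put (put w j c) i b
put-comm []      i       j       b c i≢j = refl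
put-comm (x ∷ w) zero    zero    b c i≢j = ⊥-elim (i≢j refl)
put-comm (x ∷ w) zero    (suc j) b c i≢j = refl
put-comm (x ∷ w) (suc i) zero    b c i≢j = refl
put-comm (x ∷ w) (suc i) (suc j) b c i≢j = cong (x ∷_) (put-comm w i j b c (λ e → i≢j (cong suc e)))

at-move-target : ∀ w i j → j < length w → at (move w i j) j ≡ true
at-move-target w i j j<len = at-put-same (put w i false) j true (subst (j <_) (sym (length-put w i false)) j<len)

at-move-source : ∀ w i j → i ≢ j → i < length w → at (move w i j) i ≡ false
at-move-source w i j i≢j i<len =
  trans (at-put-other (put w i false) i j true i≢j) (at-put-same w i false i<len)

at-move-other : ∀ w i j k → k ≢ i → k ≢ j → at (move w i j) k ≡ at w k
at-move-other w i j k k≢i k≢j = trans (at-put-other (put w i false) k j true k≢j) (at-put-other w k i false k≢i)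

move-undo : ∀ w i j → at w i ≡ true → at w j ≡ false → move (move w i j) j i ≡ w
move-undo w i j bead gap = begin
  put (put (put (put w i false) j true) j false) i true ≡⟨ cong (λ v → put v i true) (put-put (put w i false) j true false) ⟩
  put (put (put w i false) j false) i true             ≡⟨ cong (λ v → put v i true) (put-at (put w i false) j false (at-put-false w i j gap)) ⟩
  put (put w i false) i true                           ≡⟨ put-put w i false true ⟩
  put w i true                                         ≡⟨ put-at w i true bead ⟩
  w                                                    ∎
  where open ≡-Reasoning

move-move : ∀ w i j k → at w j ≡ false → move (move w i j) j k ≡ move w i k
move-move w i j k gap = cong (λ v → put v k true)
  (trans (put-put (put w i false) j true false) (put-at (put w i false) j false (at-put-false w i j gap)))

move-swap : ∀ w i j k → at w i ≡ true → i ≢ j → i ≢ k → j ≢ k → move (move w i j) k i ≡ move w k j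
move-swap w i j k bead i≢j i≢k j≢k = begin
  put (put (put (put w i false) j true) k false) i true ≡⟨ sym (put-comm _ i k true false i≢k) ⟩
  put (put (put (put w i false) j true) i true) k false ≡⟨ cong (λ v → put v k false) (sym (put-comm _ i j true true i≢j)) ⟩
  put (put (put (put w i false) i true) j true) k false ≡⟨ cong (λ v → put (put v j true) k false)
                                                             (trans (put-put w i false true) (put-at w i true bead)) ⟩
  put (put w j true) k false                            ≡⟨ put-comm w j k true false j≢k ⟩
  put (put w k false) j true                            ∎
  where open ≡-Reasoning

gaps≡0⇒toPartition≡[] : ∀ w → gaps w ≡ 0 → toPartition w ≡ []
gaps≡0⇒toPartition≡[] []          _  = refl
gaps≡0⇒toPartition≡[] (true ∷ w)  eq rewrite eq = refl

gap⇒0<gaps : ∀ w j → at w j ≡ false → j < length w → 0 < gaps w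
gap⇒0<gaps (false ∷ w) j       _   _       = s≤s z≤n
gap⇒0<gaps (true ∷ w)  (suc j) gap (s≤s l) = gap⇒0<gaps w j gap l

head-toPartition≤gaps : ∀ w → part (toPartition w) 0 ≤ gaps w
head-toPartition≤gaps []          = z≤n
head-toPartition≤gaps (false ∷ w) = ≤-trans (head-toPartition≤gaps w) (n≤1+n _)
head-toPartition≤gaps (true ∷ w)  = ≤-reflexive (head-∷⁺ (gaps w) (toPartition w))

toPartition-isPartition : ∀ w → IsPartition (toPartition w)
toPartition-isPartition []          = [] , []
toPartition-isPartition (false ∷ w) = toPartition-isPartition w
toPartition-isPartition (true ∷ w)  = IsPartition-∷⁺ (toPartition-isPartition w) (head-toPartition≤gaps w)

gaps-fill : ∀ w j → at w j ≡ false → j < length w → suc (gaps (put w j true)) ≡ gaps w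
gaps-fill (false ∷ w) zero    _   _       = refl
gaps-fill (false ∷ w) (suc j) gap (s≤s l) = cong suc (gaps-fill w j gap l)
gaps-fill (true ∷ w)  (suc j) gap (s≤s l) = gaps-fill w j gap l

gaps-empty : ∀ w j → at w j ≡ true → gaps (put w j false) ≡ suc (gaps w)
gaps-empty (true ∷ w)  zero    _    = refl
gaps-empty (false ∷ w) (suc j) bead = cong suc (gaps-empty w j bead)
gaps-empty (true ∷ w)  (suc j) bead = gaps-empty w j bead

gaps-move : ∀ w i j → at w i ≡ true → at w j ≡ false → j < length w → gaps (move w i j) ≡ gaps w
gaps-move w i j bead gap j<len = suc-injective (trans
  (gaps-fill (put w i false) j (at-put-false w i j gap) (subst (j <_) (sym (length-put w i false)) j<len))
  (gaps-empty w i bead))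

-- gaps w ∷ toPartition w is the partition of true ∷ w, and moving its first bead to the gap
-- at j + 1 gives the word false ∷ put w j true.
slideHead-TopHook : ∀ w j → at w j ≡ false → j < length w →
                    TopHook (suc j) (gaps w ∷ toPartition w) (toPartition (put w j true))
slideHead-TopHook (false ∷ w) zero _ _ =
  TopHook-lastCell (gaps w) (toPartition w) (gaps w ∷⁺ toPartition w) (part-∷⁺ _ _ w≡[]) (size-∷⁺ _ _ w≡[])
    (toPartition-isPartition (true ∷ w)) (head-toPartition≤gaps w)
  where w≡[] = gaps≡0⇒toPartition≡[] w
slideHead-TopHook (false ∷ w) (suc j) gap (s≤s l) =
  TopHook-extendTop (slideHead-TopHook w j gap l) (head-toPartition≤gaps w)
slideHead-TopHook (true ∷ w) (suc j) gap (s≤s l) = stack (slideHead-TopHook w j gap l) (gaps-fill w j gap l)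
  where
  y = gaps (put w j true)
  μ = toPartition (put w j true)
  μ≡[] = gaps≡0⇒toPartition≡[] (put w j true)
  stack : ∀ {Z} → TopHook (suc j) (Z ∷ toPartition w) μ → suc y ≡ Z →
          TopHook (suc (suc j)) (Z ∷ Z ∷⁺ toPartition w) (y ∷⁺ μ)
  stack h refl = TopHook-stack h (y ∷⁺ μ) (part-∷⁺ y μ μ≡[]) (size-∷⁺ y μ μ≡[])
                   (IsPartition-∷⁺ (partition h) (≤-pred (shortensTop h)))

RemoveRimHook-∷⁺ : ∀ {s z z' λs μs} → RemoveRimHook s λs μs → z' ≡ z → 0 < z → IsPartition (z' ∷⁺ μs) →
                   RemoveRimHook s (z ∷⁺ λs) (z' ∷⁺ μs)
RemoveRimHook-∷⁺ {z = suc z} r refl _ p = RemoveRimHook-∷ r p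

slide-RemoveRimHook : ∀ s w a → at w a ≡ true → at w (a + suc s) ≡ false → a + suc s < length w →
                      RemoveRimHook (suc s) (toPartition w) (toPartition (move w a (a + suc s)))
slide-RemoveRimHook s (true ∷ w) zero _ gap (s≤s l) =
  subst (λ λs → RemoveRimHook (suc s) λs (toPartition (put w s true))) (sym (∷⁺-suc _ (gap⇒0<gaps w s gap l)))
    (TopHook⇒RemoveRimHook (slideHead-TopHook w s gap l))
slide-RemoveRimHook s (false ∷ w) (suc a) bead gap (s≤s l) = slide-RemoveRimHook s w a bead gap l
slide-RemoveRimHook s (true ∷ w) (suc a) bead gap (s≤s l) =
  RemoveRimHook-∷⁺ (slide-RemoveRimHook s w a bead gap l) (gaps-move w a (a + suc s) bead gap l)
    (gap⇒0<gaps w (a + suc s) gap l) (toPartition-isPartition (true ∷ move w a (a + suc s)))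

Slide : ℕ → List Bool → List Bool → Set
Slide S w w' = ∃[ a ] (at w a ≡ true × at w (a + S) ≡ false × a + S < length w × w' ≡ move w a (a + S))

slide : ∀ {S w i j} → at w i ≡ true → at w j ≡ false → j < length w → j ≡ i + S → Slide S w (move w i j)
slide {i = i} bead gap j<len refl = i , bead , gap , j<len , refl

Slide⇒RemoveRimHook : ∀ {s w w'} → Slide (suc s) w w' → RemoveRimHook (suc s) (toPartition w) (toPartition w')
Slide⇒RemoveRimHook {s} {w} (a , bead , gap , l , refl) = slide-RemoveRimHook s w a bead gap l

infixr 5 _◅ₙ_

data Chain {A : Set} (R : A → A → Set) : ℕ → A → A → Set where
  εₙ   : ∀ {x} → Chain R 0 x x
  _◅ₙ_ : ∀ {n x y z} → R x y → Chain R n y z → Chain R (suc n) x z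

Chain-snoc : ∀ {A} {R : A → A → Set} {n x y z} → Chain R n x y → R y z → Chain R (suc n) x z
Chain-snoc εₙ        r = r ◅ₙ εₙ
Chain-snoc (r ◅ₙ rs) r' = r ◅ₙ Chain-snoc rs r'

Chain-map : ∀ {A B} {R : A → A → Set} {T : B → B → Set} (f : A → B) → (∀ {x y} → R x y → T (f x) (f y)) →
            ∀ {n x y} → Chain R n x y → Chain T n (f x) (f y)
Chain-map f g εₙ        = εₙ
Chain-map f g (r ◅ₙ rs) = g r ◅ₙ Chain-map f g rs

Chain⇒Star : ∀ {A} {R : A → A → Set} {n x y} → Chain R n x y → Star R x y
Chain⇒Star εₙ        = ε
Chain⇒Star (r ◅ₙ rs) = r ◅ Chain⇒Star rs

Star⇒Chain : ∀ {A} {R : A → A → Set} {x y} → Star R x y → ∃[ n ] Chain R n x y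
Star⇒Chain ε        = 0 , εₙ
Star⇒Chain (r ◅ rs) = let n , c = Star⇒Chain rs in suc n , r ◅ₙ c

size-Chain : ∀ {S n λs μs} → Chain (RemoveRimHook S) n λs μs → size λs ≡ size μs + n * S
size-Chain {S} εₙ = sym (+-identityʳ _)
size-Chain {S} {suc n} {λs} {μs} (_◅ₙ_ {y = νs} r rs) = begin
  size λs              ≡⟨ RemoveRimHook.hookSize r ⟩
  size νs + S          ≡⟨ cong (_+ S) (size-Chain rs) ⟩
  size μs + n * S + S  ≡⟨ +-assoc (size μs) (n * S) S ⟩
  size μs + (n * S + S) ≡⟨ cong (size μs +_) (+-comm (n * S) S) ⟩
  size μs + (S + n * S) ∎
  where open ≡-Reasoning

-- A bead moved back along its runner by q + 1 steps of length S is brought back by q + 1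
-- slides: if the next place on the runner is a gap, the moved bead slides into it first;
-- otherwise the bead there is moved back in its stead, and slides forward last.
slides-undoMove : ∀ {s} q w a B → B ≡ a + suc q * suc s → at w a ≡ false → at w B ≡ true → B < length w →
                  Chain (Slide (suc s)) (suc q) (move w B a) w
slides-undoMove {s} zero w a B eB gap bead B<len =
  subst (Chain (Slide (suc s)) 1 (move w B a)) (move-undo w B a bead gap)
    (slide (at-move-target w B a a<len) (at-move-source w B a (>⇒≢ a<B) B<len)
           (subst (B <_) (sym (length-move w B a)) B<len) B≡a+S
     ◅ₙ εₙ)
  where
  B≡a+S : B ≡ a + suc s
  B≡a+S = trans eB (cong (a +_) (+-identityʳ (suc s)))
  a<B : a < B
  a<B = subst (a <_) (sym B≡a+S) (m<m+n a (s≤s z≤n))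
  a<len = <-trans a<B B<len
slides-undoMove {s} (suc q) w a B eB gap bead B<len = byNext (at w a') refl
  where
  S  = suc s
  a' = a + S
  B≡a'+ : B ≡ a' + suc q * S
  B≡a'+ = trans eB (sym (+-assoc a S (suc q * S)))
  a<a' : a < a'
  a<a' = m<m+n a (s≤s z≤n)
  a'<B : a' < B
  a'<B = subst (a' <_) (sym B≡a'+) (m<m+n a' (s≤s z≤n))
  a'<len = <-trans a'<B B<len
  a<len  = <-trans a<a' a'<len
  byNext : (b : Bool) → at w a' ≡ b → Chain (Slide S) (suc (suc q)) (move w B a) w
  byNext false gap' = first ◅ₙ slides-undoMove q w a' B B≡a'+ gap' bead B<len
    where
    first : Slide S (move w B a) (move w B a')
    first = subst (Slide S (move w B a)) (move-move w B a a' gap)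
      (slide (at-move-target w B a a<len)
             (trans (at-move-other w B a a' (<⇒≢ a'<B) (>⇒≢ a<a')) gap')
             (subst (a' <_) (sym (length-move w B a)) a'<len) refl)
  byNext true bead' = Chain-snoc rest last
    where
    D = move w a' a
    rest : Chain (Slide S) (suc q) (move w B a) D
    rest = subst (λ v → Chain (Slide S) (suc q) v D) (move-swap w a' a B bead' (>⇒≢ a<a') (<⇒≢ a'<B) (<⇒≢ (<-trans a<a' a'<B)))
      (slides-undoMove q D a' B B≡a'+ (at-move-source w a' a (>⇒≢ a<a') a'<len)
        (trans (at-move-other w a' a B (>⇒≢ a'<B) (>⇒≢ (<-trans a<a' a'<B))) bead)
        (subst (B <_) (sym (length-move w a' a)) B<len))
    last : Slide S D w
    last = subst (Slide S D) (move-undo w a' a bead' gap)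
      (slide (at-move-target w a' a a<len) (at-move-source w a' a (>⇒≢ a<a') a'<len)
             (subst (a' <_) (sym (length-move w a' a)) a'<len) refl)

word : List ℕ → List Bool
word []       = []
word (x ∷ xs) = true ∷ (replicate (x ∸ part xs 0) false ++ word xs)

gaps-gaps++ : ∀ c w → gaps (replicate c false ++ w) ≡ c + gaps w
gaps-gaps++ zero    w = refl
gaps-gaps++ (suc c) w = cong suc (gaps-gaps++ c w)

toPartition-gaps++ : ∀ c w → toPartition (replicate c false ++ w) ≡ toPartition w
toPartition-gaps++ zero    w = refl
toPartition-gaps++ (suc c) w = toPartition-gaps++ c w

gaps-beads : ∀ c → gaps (replicate c true) ≡ 0
gaps-beads zero    = refl
gaps-beads (suc c) = gaps-beads c

gaps-++beads : ∀ w c → gaps (w ++ replicate c true) ≡ gaps w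
gaps-++beads []          c = gaps-beads c
gaps-++beads (false ∷ w) c = cong suc (gaps-++beads w c)
gaps-++beads (true ∷ w)  c = gaps-++beads w c

toPartition-++beads : ∀ w c → toPartition (w ++ replicate c true) ≡ toPartition w
toPartition-++beads []          c = gaps≡0⇒toPartition≡[] (replicate c true) (gaps-beads c)
toPartition-++beads (false ∷ w) c = toPartition-++beads w c
toPartition-++beads (true ∷ w)  c = cong₂ _∷⁺_ (gaps-++beads w c) (toPartition-++beads w c)

gaps-word : ∀ xs → IsPartition xs → gaps (word xs) ≡ part xs 0
gaps-word []       p = refl
gaps-word (x ∷ xs) p = begin
  gaps (replicate (x ∸ part xs 0) false ++ word xs) ≡⟨ gaps-gaps++ (x ∸ part xs 0) (word xs) ⟩
  x ∸ part xs 0 + gaps (word xs)                    ≡⟨ cong (x ∸ part xs 0 +_) (gaps-word xs (IsPartition-tail p)) ⟩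
  x ∸ part xs 0 + part xs 0                         ≡⟨ m∸n+n≡m (IsPartition-head p) ⟩
  x                                                 ∎
  where open ≡-Reasoning

toPartition-word : ∀ xs → IsPartition xs → toPartition (word xs) ≡ xs
toPartition-word []       p = refl
toPartition-word (x ∷ xs) p@(_ , 1≤x ∷ _) = trans
  (cong₂ _∷⁺_ (gaps-word (x ∷ xs) p)
              (trans (toPartition-gaps++ (x ∸ part xs 0) (word xs)) (toPartition-word xs (IsPartition-tail p))))
  (∷⁺-suc xs 1≤x)

at-gaps++ : ∀ c w i → i < c → at (replicate c false ++ w) i ≡ false
at-gaps++ (suc c) w zero    _       = refl
at-gaps++ (suc c) w (suc i) (s≤s l) = at-gaps++ c w i l

at-beads : ∀ c i → i < c → at (replicate c true) i ≡ true
at-beads (suc c) zero    _       = refl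
at-beads (suc c) (suc i) (s≤s l) = at-beads c i l

at-++ : ∀ v w i → at (v ++ w) (length v + i) ≡ at w i
at-++ []      w i = refl
at-++ (x ∷ v) w i = at-++ v w i

gaps≡0⇒beads : ∀ w → gaps w ≡ 0 → w ≡ replicate (length w) true
gaps≡0⇒beads []         _  = refl
gaps≡0⇒beads (true ∷ w) eq = cong (true ∷_) (gaps≡0⇒beads w eq)

toPartition-injective : ∀ w w' → length w ≡ length w' → gaps w ≡ gaps w' → toPartition w ≡ toPartition w' → w ≡ w'
toPartition-injective []          []           _ _ _ = refl
toPartition-injective (false ∷ w) (false ∷ w') l g p =
  cong (false ∷_) (toPartition-injective w w' (suc-injective l) (suc-injective g) p)
toPartition-injective (true ∷ w) (true ∷ w') l g p with gaps w in gw
... | zero  = cong (true ∷_) (trans (gaps≡0⇒beads w gw)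
                (trans (cong (λ n → replicate n true) (suc-injective l)) (sym (gaps≡0⇒beads w' (sym g)))))
... | suc y = cong (true ∷_) (toPartition-injective w w' (suc-injective l) (trans gw g)
                (∷⁺-injectiveʳ y (toPartition w) (gaps w') (toPartition w') p g))
toPartition-injective (true ∷ w) (false ∷ w') l g p = ⊥-elim (<-irrefl refl (begin-strict
  gaps w                        ≡⟨ sym (head-∷⁺ (gaps w) (toPartition w)) ⟩
  part (toPartition (true ∷ w)) 0 ≡⟨ cong (λ μ → part μ 0) p ⟩
  part (toPartition w') 0        ≤⟨ head-toPartition≤gaps w' ⟩
  gaps w'                       <⟨ ≤-refl ⟩
  suc (gaps w')                 ≡⟨ sym g ⟩
  gaps w                        ∎))
  where open ≤-Reasoning
toPartition-injective (false ∷ w) (true ∷ w') l g p =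
  sym (toPartition-injective (true ∷ w') (false ∷ w) (sym l) (sym g) (sym p))

firstTrue : (f : ℕ → Bool) (j : ℕ) → f j ≡ true → Σ[ j₀ ∈ ℕ ] (f j₀ ≡ true × (∀ i → i < j₀ → f i ≡ false))
firstTrue f zero    fj = 0 , fj , λ i ()
firstTrue f (suc j) fj with f 0 in f0
... | true  = 0 , f0 , λ i ()
... | false with firstTrue (λ i → f (suc i)) j fj
...   | j₀ , fj₀ , before = suc j₀ , fj₀ , λ { zero _ → f0 ; (suc i) (s≤s i<j₀) → before i i<j₀ }

-- Lifting a minimal partition

module Lifts (s' t' k' : ℕ) (μ : List ℕ) (pμ : IsPartition μ) where
  s = suc s'
  t = suc t'
  k = suc k'
  N = s * t
  E = length (word μ)

  -- Chosen so that every runner modulo N starts with k gaps and its place k + E lies in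
  -- the final beads.
  padding : ℕ
  padding = k * N + E * pred N

  padded : List Bool
  padded = replicate padding false ++ (word μ ++ replicate N true)

  toPartition-padded : toPartition padded ≡ μ
  toPartition-padded = trans (toPartition-gaps++ padding _)
    (trans (toPartition-++beads (word μ) N) (toPartition-word μ pμ))

  runner-% : ∀ r j → r < N → (r + j * N) % N ≡ r
  runner-% r j r<N = trans ([m+kn]%n≡m%n r j N) (m≤n⇒m%n≡m (≤-pred r<N))

  runner-start : ∀ r j → r < N → j < k → at padded (r + j * N) ≡ false
  runner-start r j r<N j<k = at-gaps++ padding _ (r + j * N) (begin-strict
    r + j * N          <⟨ +-monoˡ-< (j * N) r<N ⟩
    suc j * N          ≤⟨ *-monoˡ-≤ N j<k ⟩
    k * N              ≤⟨ m≤m+n (k * N) (E * pred N) ⟩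
    padding            ∎)
    where open ≤-Reasoning

  runner-end : ∀ r → r < N → at padded (r + (k + E) * N) ≡ true
  runner-end r r<N = begin
    at padded (r + (k + E) * N)                    ≡⟨ cong (at padded) (reorder r k E (pred N)) ⟩
    at padded (padding + (E + r))                  ≡⟨ cong (λ c → at padded (c + (E + r))) (sym (length-replicate padding)) ⟩
    at padded (length (replicate padding false) + (E + r)) ≡⟨ at-++ (replicate padding false) _ (E + r) ⟩
    at (word μ ++ replicate N true) (E + r)        ≡⟨ at-++ (word μ) _ r ⟩
    at (replicate N true) r                        ≡⟨ at-beads N r r<N ⟩
    true                                           ∎
    where
    open ≡-Reasoning
    reorder : ∀ r k E N' → r + (k + E) * suc N' ≡ k * suc N' + E * N' + (E + r)
    reorder = solve-∀

  record BackMove (r : ℕ) : Set where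
    field
      gap bead : ℕ
      bead≡    : bead ≡ gap + k * N
      isGap    : at padded gap ≡ false
      isBead   : at padded bead ≡ true
      gap%N    : gap % N ≡ r
      bead%N   : bead % N ≡ r

  -- The bead is the first one on its runner, so the place k N before it is a gap.
  backMove : ∀ r → r < N → BackMove r
  backMove r r<N with firstTrue (λ j → at padded (r + j * N)) (k + E) (runner-end r r<N)
  ... | j₀ , isBead , before with k ≤? j₀
  ...   | no k≰j₀ = ⊥-elim (true≢false (trans (sym isBead) (runner-start r j₀ r<N (≰⇒> k≰j₀))))
  ...   | yes k≤j₀ = record
    { gap = r + d * N ; bead = r + j₀ * N ; bead≡ = bead≡
    ; isGap = before d d<j₀ ; isBead = isBead ; gap%N = runner-% r d r<N ; bead%N = runner-% r j₀ r<N }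
    where
    d = j₀ ∸ k
    j₀≡k+d : j₀ ≡ k + d
    j₀≡k+d = sym (m+[n∸m]≡n k≤j₀)
    reorder : ∀ r k d N → r + (k + d) * N ≡ r + d * N + k * N
    reorder = solve-∀
    bead≡ : r + j₀ * N ≡ r + d * N + k * N
    bead≡ = trans (cong (λ j → r + j * N) j₀≡k+d) (reorder r k d N)
    d<j₀ : d < j₀
    d<j₀ = subst (d <_) (sym j₀≡k+d) (s≤s (m≤n+m d k'))

  module _ {r} (c : BackMove r) where
    open BackMove c

    lift : List Bool
    lift = move padded bead gap

    gap<length : gap < length padded
    gap<length = ≤-<-trans (subst (gap ≤_) (sym bead≡) (m≤m+n gap (k * N))) (at-true⇒< padded bead isBead)

    at-lift-gap : at lift gap ≡ true
    at-lift-gap = at-move-target padded bead gap gap<length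

    gaps-lift : gaps lift ≡ gaps padded
    gaps-lift = gaps-move padded bead gap isBead isGap gap<length

    lift-reduces : ∀ {h} q → k * N ≡ suc q * suc h → Chain (RemoveRimHook (suc h)) (suc q) (toPartition lift) μ
    lift-reduces q eq = subst (Chain _ _ _) toPartition-padded (Chain-map toPartition Slide⇒RemoveRimHook
      (slides-undoMove q padded gap bead (trans bead≡ (cong (gap +_) eq)) isGap isBead (at-true⇒< padded bead isBead)))

    lift-reduces-s : Chain (RemoveRimHook s) (k * t) (toPartition lift) μ
    lift-reduces-s = lift-reduces (t' + k' * t) (trans (cong (k *_) (*-comm s t)) (sym (*-assoc k t s)))

    lift-reduces-t : Chain (RemoveRimHook t) (k * s) (toPartition lift) μ
    lift-reduces-t = lift-reduces (s' + k' * s) (sym (*-assoc k s t))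

    size-lift : size (toPartition lift) ≡ size μ + k * N
    size-lift = trans (size-Chain lift-reduces-s) (cong (size μ +_) (trans (*-assoc k t s) (cong (k *_) (*-comm t s))))

  lift-residue : ∀ {r₁ r₂} (c₁ : BackMove r₁) (c₂ : BackMove r₂) → toPartition (lift c₁) ≡ toPartition (lift c₂) → r₁ ≡ r₂
  lift-residue {r₁} {r₂} c₁ c₂ eq = decidable-stable (r₁ ≟ r₂) λ r₁≢r₂ → true≢false (begin
    true            ≡⟨ sym (at-lift-gap c₁) ⟩
    at (lift c₁) a₁ ≡⟨ cong (λ w → at w a₁) lifts≡ ⟩
    at (lift c₂) a₁ ≡⟨ at-move-other padded B₂ a₂ a₁ (λ e → r₁≢r₂ (trans (sym ra₁) (trans (cong (_% N) e) rB₂)))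
                                                     (λ e → r₁≢r₂ (trans (sym ra₁) (trans (cong (_% N) e) ra₂))) ⟩
    at padded a₁    ≡⟨ BackMove.isGap c₁ ⟩
    false           ∎)
    where
    open BackMove c₁ using () renaming (gap to a₁; bead to B₁; gap%N to ra₁)
    open BackMove c₂ using () renaming (gap to a₂; bead to B₂; gap%N to ra₂; bead%N to rB₂)
    open ≡-Reasoning
    lifts≡ : lift c₁ ≡ lift c₂
    lifts≡ = toPartition-injective (lift c₁) (lift c₂)
      (trans (length-move padded B₁ a₁) (sym (length-move padded B₂ a₂)))
      (trans (gaps-lift c₁) (sym (gaps-lift c₂))) eq

opaque
  lifts : ∀ s' t' k' μ → IsPartition μ →
          Σ[ F ∈ (Fin (suc s' * suc t') → List ℕ) ] (Injective _≡_ _≡_ F ×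
            (∀ ρ → IsPartition (F ρ) × size (F ρ) ≡ size μ + suc k' * (suc s' * suc t')
                 × Star (RemoveRimHook (suc s')) (F ρ) μ × Star (RemoveRimHook (suc t')) (F ρ) μ))
  lifts s' t' k' μ pμ = F , F-injective ,
    λ ρ → toPartition-isPartition (lift (c ρ)) , size-lift (c ρ) , Chain⇒Star (lift-reduces-s (c ρ)) , Chain⇒Star (lift-reduces-t (c ρ))
    where
    open Lifts s' t' k' μ pμ
    c : (ρ : Fin N) → BackMove (toℕ ρ)
    c ρ = backMove (toℕ ρ) (toℕ<n ρ)
    F : Fin N → List ℕ
    F ρ = toPartition (lift (c ρ))
    F-injective : Injective _≡_ _≡_ F
    F-injective eq = toℕ-injective (lift-residue (c _) (c _) eq)

sameCore⇒∣size∸size : ∀ {S λs μs κ} → Star (RemoveRimHook S) λs κ → Star (RemoveRimHook S) μs κ →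
                      S ∣ size λs ∸ size μs
sameCore⇒∣size∸size {S} {λs} {μs} {κ} λ→κ μ→κ with Star⇒Chain λ→κ | Star⇒Chain μ→κ
... | c₁ , ch₁ | c₂ , ch₂ = divides (c₁ ∸ c₂) (begin
  size λs ∸ size μs                     ≡⟨ cong₂ _∸_ (size-Chain ch₁) (size-Chain ch₂) ⟩
  (size κ + c₁ * S) ∸ (size κ + c₂ * S) ≡⟨ [m+n]∸[m+o]≡n∸o (size κ) (c₁ * S) (c₂ * S) ⟩
  c₁ * S ∸ c₂ * S                       ≡⟨ sym (*-distribʳ-∸ S c₁ c₂) ⟩
  (c₁ ∸ c₂) * S                         ∎)
  where open ≡-Reasoning

coprime⇒*∣ : ∀ {s t d} → Coprime s t → s ∣ d → t ∣ d → s * t ∣ d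
coprime⇒*∣ {s} {t} cop s∣d t∣d = subst (_∣ _) lcm≡s*t (lcm-least s∣d t∣d)
  where
  lcm≡s*t : lcm s t ≡ s * t
  lcm≡s*t = trans (sym (*-identityˡ (lcm s t))) (trans (cong (_* lcm s t) (sym (coprime⇒gcd≡1 cop))) (gcd*lcm s t))

injective⇒distinct : ∀ {n} {P : List ℕ → Set} (F : Fin n → List ℕ) → Injective _≡_ _≡_ F → (∀ ρ → P (F ρ)) →
                     ∃[ ps ] (length ps ≡ n × Unique ps × All P ps)
injective⇒distinct {n} F F-injective PF =
  map F (allFin n) , trans (length-map F (allFin n)) (length-tabulate (λ ρ → ρ)) ,
  Unique-map⁺ F-injective (allFin⁺ n) , All-map⁺ (tabulate⁺ PF)

proposition3p1 : (s t : ℕ) → Coprime s t → 1 < s → 1 < t →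
    (σ τ : List ℕ) → IsPartition σ → IsCore s σ → IsPartition τ → IsCore t τ →
    (m : ℕ) → IsMinSize s t σ τ m → (n : ℕ) →
      (PNonempty s t σ τ n ⇔ (m ≤ n × s * t ∣ n ∸ m))
      × (m < n → s * t ∣ n ∸ m → CardAtLeast s t σ τ n (s * t))
proposition3p1 (suc s') (suc t') cop _ _ σ τ _ _ _ _ _
  (μ∈P@(μ , pμ , refl , (μ→σ , σ-core) , (μ→τ , τ-core)) , minimal) n = mk⇔ necessary sufficient , many
  where
  s = suc s'
  t = suc t'
  n≡m+ : ∀ {q} → size μ ≤ n → n ∸ size μ ≡ q → n ≡ size μ + q
  n≡m+ m≤n eq = trans (sym (m+[n∸m]≡n m≤n)) (cong (size μ +_) eq)
  lifts∈P : ∀ k' → n ≡ size μ + suc k' * (s * t) → ∀ ρ → InP s t σ τ n (proj₁ (lifts s' t' k' μ pμ) ρ)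
  lifts∈P k' refl ρ with proj₂ (proj₂ (lifts s' t' k' μ pμ)) ρ
  ... | pλ , size-λ , λ→μ , λ→μ' = pλ , size-λ , (λ→μ ◅◅ μ→σ , σ-core) , (λ→μ' ◅◅ μ→τ , τ-core)
  necessary : PNonempty s t σ τ n → size μ ≤ n × s * t ∣ n ∸ size μ
  necessary λ∈P@(_ , _ , refl , (λ→σ , _) , (λ→τ , _)) =
    ≮⇒≥ (λ n<m → minimal n n<m λ∈P) , coprime⇒*∣ cop (sameCore⇒∣size∸size λ→σ μ→σ) (sameCore⇒∣size∸size λ→τ μ→τ)
  sufficient : size μ ≤ n × s * t ∣ n ∸ size μ → PNonempty s t σ τ n
  sufficient (m≤n , divides zero eq)     = subst (PNonempty s t σ τ) (sym (trans (n≡m+ m≤n eq) (+-identityʳ _))) μ∈P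
  sufficient (m≤n , divides (suc k') eq) = _ , lifts∈P k' (n≡m+ m≤n eq) zero
  many : size μ < n → s * t ∣ n ∸ size μ → CardAtLeast s t σ τ n (s * t)
  many m<n (divides zero eq)     = ⊥-elim (<-irrefl (sym (trans (n≡m+ (<⇒≤ m<n) eq) (+-identityʳ _))) m<n)
  many m<n (divides (suc k') eq) = let F , F-injective , _ = lifts s' t' k' μ pμ in
    injective⇒distinct F F-injective (lifts∈P k' (n≡m+ (<⇒≤ m<n) eq))
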